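{- Let \(\mathbb{E}\) be the set of positive even integers, \(N\subseteq\mathbb{E}\), \(F\) an ultrafilter over a set \(I\), and \(\mathbf{S}\) a subalgebra of \(\mathbf{D}_N^I/F\). If \(\mathbf{S}\) satisfies \(\exists x\,(x\neq 0\ \&\ \Diamond x\neq 1)\), then \(\mathbf{D}_N\) is isomorphic to a subalgebra of \(\mathbf{S}\).
   Context: The complex algebra \(\mathsf{Cm}(\langle W;R\rangle)\) is the power set Boolean algebra of \(W\) with \(\Diamond X=\{w\in W\mid w\,R\,x\text{ for some }x\in X\}\). The frame \(\mathbb{F}_N=\langle W;R_N\rangle\): \(W\) consists of pairwise distinct elements \(a,b_1,b_2,b_3,c_1,c_2,d\), \(u_i\) (\(i\geqslant 1\)) and \(\ell_i\) (\(i\geqslant 0\)); \(R_N\) is the reflexive symmetric relation on \(W\) whose non-loop edges \(\{x,y\}\) are exactly: \(\{a,b_i\}\) for \(i\in\{1,2,3\}\); \(\{b_i,c_i\}\) for \(i\in\{1,2\}\); \(\{c_1,d\}\); \(\{\ell_0,\ell_1\}\); \(\{a,\ell_i\}\) for all \(i\geqslant 0\); \(\{\ell_i,u_i\}\) for all \(i\geqslant 1\); \(\{\ell_i,u_{i-1}\}\) for \(i\in\mathbb{E}\); \(\{\ell_i,u_{i+1}\}\) for \(i\in N\); \(\{\ell_{i+1},u_i\}\) for \(i\in\mathbb{E}\setminus N\). \(\mathbf{D}_N\) is the subalgebra of \(\mathsf{Cm}(\mathbb{F}_N)\) generated by \(\{d\}\). -}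

module Defs where

open import Level using (Level; _⊔_) renaming (suc to lsuc; zero to lzero)
open import Data.Nat using (ℕ; zero; suc; _≤_)
open import Data.Nat.Divisibility using (_∣_)
open import Data.Product using (Σ; _×_; _,_)
open import Data.Sum using (_⊎_)
open import Data.Empty using (⊥)
open import Data.Unit using (⊤)
open import Relation.Nullary using (¬_)
open import Relation.Binary.PropositionalEquality using (_≡_)
open import Function.Bundles using (_⇔_)

IsE : ℕ → Set
IsE n = (1 ≤ n) × (2 ∣ n)

record SubsetE : Set₁ where
  field
    mem  : ℕ → Set
    sub  : ∀ n → mem n → IsE n

-- The set W.   u₊ k  stands for  u_{k+1}  (the u's are indexed from 1),
-- ℓ i stands for ℓ_i (indexed from 0).

data W : Set where
  a b₁ b₂ b₃ c₁ c₂ d : W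
  u₊ : ℕ → W
  ℓ  : ℕ → W

-- non-loop edges {x,y} of R_N (listed in one orientation)
data Edge (N : SubsetE) : W → W → Set where
  ab₁ : Edge N a b₁
  ab₂ : Edge N a b₂
  ab₃ : Edge N a b₃
  b₁c₁ : Edge N b₁ c₁
  b₂c₂ : Edge N b₂ c₂
  c₁d  : Edge N c₁ d
  ℓ₀ℓ₁ : Edge N (ℓ 0) (ℓ 1)
  aℓ   : ∀ i → Edge N a (ℓ i)
  -- {ℓ_i , u_i}, i ≥ 1   (i = k+1)
  ℓu-same : ∀ k → Edge N (ℓ (suc k)) (u₊ k)
  -- {ℓ_i , u_{i-1}}, i ∈ 𝔼   (i = k+2, so u_{i-1} = u_{k+1})
  ℓu-pred : ∀ k → IsE (suc (suc k)) → Edge N (ℓ (suc (suc k))) (u₊ k)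
  -- {ℓ_i , u_{i+1}}, i ∈ N
  ℓu-succ : ∀ i → SubsetE.mem N i → Edge N (ℓ i) (u₊ i)
  -- {ℓ_{i+1} , u_i}, i ∈ 𝔼 ∖ N   (i = k+1)
  ℓu-EN : ∀ k → IsE (suc k) → ¬ SubsetE.mem N (suc k) → Edge N (ℓ (suc (suc k))) (u₊ k)

R : SubsetE → W → W → Set
R N x y = (x ≡ y) ⊎ (Edge N x y ⊎ Edge N y x)

record BAO (c e : Level) : Set (lsuc (c ⊔ e)) where
  field
    Carrier : Set c
    _≈_     : Carrier → Carrier → Set e
    𝟘 𝟙     : Carrier
    _∨_ _∧_ : Carrier → Carrier → Carrier
    ∁       : Carrier → Carrier
    ◇       : Carrier → Carrier

Cm : SubsetE → BAO (lsuc lzero) lzero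
Cm N = record
  { Carrier = W → Set
  ; _≈_ = λ X Y → ∀ w → X w ⇔ Y w
  ; 𝟘 = λ _ → ⊥
  ; 𝟙 = λ _ → ⊤
  ; _∨_ = λ X Y w → X w ⊎ Y w
  ; _∧_ = λ X Y w → X w × Y w
  ; ∁ = λ X w → ¬ X w
  ; ◇ = λ X w → Σ W (λ x → R N w x × X x)
  }

data InD (N : SubsetE) : (W → Set) → Set₁ where
  gen-d : InD N (λ w → w ≡ d)
  gen-𝟘 : InD N (BAO.𝟘 (Cm N))
  gen-𝟙 : InD N (BAO.𝟙 (Cm N))
  gen-∨ : ∀ {X Y} → InD N X → InD N Y → InD N (BAO._∨_ (Cm N) X Y)
  gen-∧ : ∀ {X Y} → InD N X → InD N Y → InD N (BAO._∧_ (Cm N) X Y)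
  gen-∁ : ∀ {X} → InD N X → InD N (BAO.∁ (Cm N) X)
  gen-◇ : ∀ {X} → InD N X → InD N (BAO.◇ (Cm N) X)
  -- elements of Cm are subsets, i.e. taken up to extensional equality
  gen-≈ : ∀ {X Y} → BAO._≈_ (Cm N) X Y → InD N X → InD N Y

D : SubsetE → BAO (lsuc lzero) lzero
D N = record
  { Carrier = Σ (W → Set) (InD N)
  ; _≈_ = λ X Y → BAO._≈_ (Cm N) (proj X) (proj Y)
  ; 𝟘 = BAO.𝟘 (Cm N) , gen-𝟘
  ; 𝟙 = BAO.𝟙 (Cm N) , gen-𝟙
  ; _∨_ = λ X Y → BAO._∨_ (Cm N) (proj X) (proj Y) , gen-∨ (prf X) (prf Y)
  ; _∧_ = λ X Y → BAO._∧_ (Cm N) (proj X) (proj Y) , gen-∧ (prf X) (prf Y)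
  ; ∁ = λ X → BAO.∁ (Cm N) (proj X) , gen-∁ (prf X)
  ; ◇ = λ X → BAO.◇ (Cm N) (proj X) , gen-◇ (prf X)
  }
  where
  proj : Σ (W → Set) (InD N) → W → Set
  proj (X , _) = X
  prf : (X : Σ (W → Set) (InD N)) → InD N (proj X)
  prf (_ , p) = p

record Ultrafilter (I : Set) : Set₁ where
  field
    Mem      : (I → Set) → Set
    upward   : ∀ {A B} → (∀ i → A i → B i) → Mem A → Mem B
    meet     : ∀ {A B} → Mem A → Mem B → Mem (λ i → A i × B i)
    full     : Mem (λ _ → ⊤)
    proper   : ¬ Mem (λ _ → ⊥)
    ultra    : ∀ A → Mem A ⊎ Mem (λ i → ¬ A i)

Ultrapower : ∀ {c} → BAO c lzero → (I : Set) → Ultrafilter I → BAO c lzero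
Ultrapower A I F = record
  { Carrier = I → Carrier
  ; _≈_ = λ f g → Mem (λ i → f i ≈ g i)
  ; 𝟘 = λ _ → 𝟘
  ; 𝟙 = λ _ → 𝟙
  ; _∨_ = λ f g i → f i ∨ g i
  ; _∧_ = λ f g i → f i ∧ g i
  ; ∁ = λ f i → ∁ (f i)
  ; ◇ = λ f i → ◇ (f i)
  }
  where open BAO A
        open Ultrafilter F

record Subalgebra {c e} (A : BAO c e) (s : Level) : Set (lsuc s ⊔ c ⊔ e) where
  open BAO A
  field
    In     : Carrier → Set s
    resp   : ∀ {x y} → x ≈ y → In x → In y
    In-𝟘   : In 𝟘
    In-𝟙   : In 𝟙
    In-∨   : ∀ {x y} → In x → In y → In (x ∨ y)
    In-∧   : ∀ {x y} → In x → In y → In (x ∧ y)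
    In-∁   : ∀ {x} → In x → In (∁ x)
    In-◇   : ∀ {x} → In x → In (◇ x)

SatisfiesCond : ∀ {c e s} {A : BAO c e} → Subalgebra A s → Set (c ⊔ e ⊔ s)
SatisfiesCond {A = A} S =
  Σ Carrier (λ x → In x × (¬ (x ≈ 𝟘)) × (¬ (◇ x ≈ 𝟙)))
  where open BAO A
        open Subalgebra S

-- an embedding of B into the subalgebra S of A (i.e. B is isomorphic to a
-- subalgebra of S): an injective homomorphism B → A with image inside S
record EmbedsInto {c₁ e₁ c₂ e₂ s} (B : BAO c₁ e₁) (A : BAO c₂ e₂)
                  (S : Subalgebra A s) : Set (c₁ ⊔ e₁ ⊔ c₂ ⊔ e₂ ⊔ s) where
  module B = BAO B
  module A = BAO A
  field
    h      : B.Carrier → A.Carrier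
    into   : ∀ x → Subalgebra.In S (h x)
    cong   : ∀ {x y} → x B.≈ y → h x A.≈ h y
    inj    : ∀ {x y} → h x A.≈ h y → x B.≈ y
    pres-𝟘 : h B.𝟘 A.≈ A.𝟘
    pres-𝟙 : h B.𝟙 A.≈ A.𝟙
    pres-∨ : ∀ x y → h (x B.∨ y) A.≈ (h x A.∨ h y)
    pres-∧ : ∀ x y → h (x B.∧ y) A.≈ (h x A.∧ h y)
    pres-∁ : ∀ x → h (B.∁ x) A.≈ A.∁ (h x)
    pres-◇ : ∀ x → h (B.◇ x) A.≈ A.◇ (h x)

-- The diagonal map D_N → D_N^I/F is an embedding, so it suffices that S contains the constant
-- {d}: as D_N is generated by {d}, S then contains every constant.  We give a unary term dTerm
-- with dTerm(X) = {d} in Cm(F_N) whenever X ≠ 0 and ◇X ≠ 1; applied coordinatewise to the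
-- witness x ∈ S, it yields {d} on an F-large set.
--
-- F_N has diameter 5, attained only between d and the rim {c₂} ∪ {u_k}.  Call A polar if it is
-- a nonempty subset of {d} or of the rim.  A is polar iff A and the set of points at distance
-- > 4 from A are both nonempty, and then these far points, together with the points far from
-- them, form {d} ∪ rim; b₃ is the only point at distance exactly 3 from that set, and d the
-- only point at distance > 3 from b₃.  Hence atD(A) is {d} for polar A and empty otherwise.
-- With Q = ¬◇X and P = ¬◇Q, splitting on whether a lies in P, in Q or in neither shows that
-- one of six sets built from P and Q is polar, and dTerm joins atD over those six.

module Submission where

open import Defs
open import Level using () renaming (suc to lsuc; zero to lzero)
open import Axiom.ExcludedMiddle using (ExcludedMiddle)
open import Data.Nat using (ℕ; zero; suc; _+_; _≤_; z≤n; s≤s)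
open import Data.Nat.Properties
  using (≤ᵇ⇒≤; n≤1+n; ≤-reflexive; ≤-antisym; <-irrefl; ≰⇒>; _≤?_; +-suc; +-identityʳ; +-monoˡ-≤;
         module ≤-Reasoning)
open import Data.List using (List; []; _∷_; foldr; map)
open import Data.List.Relation.Unary.All using (All; []; _∷_)
open import Data.List.Relation.Unary.Any using (Any; here; there; satisfied)
import Data.List.Relation.Unary.Any as Any
open import Data.Product using (Σ; ∃; _×_; _,_; proj₁; proj₂)
open import Data.Sum using (_⊎_; inj₁; inj₂; [_,_]′)
import Data.Sum as Sum
open import Data.Empty using (⊥-elim)
open import Data.Unit using (tt)
open import Relation.Nullary using (¬_; Dec; yes; no; contradiction)
open import Relation.Unary using (_⊆_; _≐_; Satisfiable)
open import Relation.Binary.PropositionalEquality using (_≡_; _≢_; refl; sym; subst)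
open import Function.Base using (case_of_; _∘_)
open import Function.Bundles using (mk⇔)
import Function.Properties.Equivalence as ⇔

module Terms {c e} (A : BAO c e) where
  open BAO A

  ◇ⁿ : ℕ → Carrier → Carrier
  ◇ⁿ zero    x = x
  ◇ⁿ (suc k) x = ◇ (◇ⁿ k x)

  beyond : ℕ → Carrier → Carrier
  beyond k x = ∁ (◇ⁿ k x)

  sphere : ℕ → Carrier → Carrier
  sphere zero    x = x
  sphere (suc k) x = ◇ⁿ (suc k) x ∧ beyond k x

  ⋁ : List Carrier → Carrier
  ⋁ = foldr _∨_ 𝟘

  farPair : Carrier → Carrier
  farPair x = ◇ⁿ 5 x ∧ ◇ⁿ 5 (beyond 4 x)

  antipodes : Carrier → Carrier
  antipodes x = beyond 4 x ∨ beyond 4 (beyond 4 x)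

  atD : Carrier → Carrier
  atD x = farPair x ∧ beyond 3 (sphere 3 (antipodes x))

  candidates : Carrier → List Carrier
  candidates x = p ∷ q ∷ beyond 3 (beyond 2 p) ∷ beyond 3 (beyond 2 q)
               ∷ sphere 2 b ∷ sphere 3 b ∷ []
    where
    q p b : Carrier
    q = beyond 1 x
    p = beyond 1 q
    b = ◇ p ∧ ◇ q

  dTerm : Carrier → Carrier
  dTerm x = ⋁ (map atD (candidates x))

module TermsIn {c e s} {A : BAO c e} (S : Subalgebra A s) where
  open BAO A
  open Subalgebra S
  open Terms A

  In-◇ⁿ : ∀ k {x} → In x → In (◇ⁿ k x)
  In-◇ⁿ zero    x∈ = x∈
  In-◇ⁿ (suc k) x∈ = In-◇ (In-◇ⁿ k x∈)

  In-beyond : ∀ k {x} → In x → In (beyond k x)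
  In-beyond k x∈ = In-∁ (In-◇ⁿ k x∈)

  In-sphere : ∀ k {x} → In x → In (sphere k x)
  In-sphere zero    x∈ = x∈
  In-sphere (suc k) x∈ = In-∧ (In-◇ⁿ (suc k) x∈) (In-beyond k x∈)

  In-farPair : ∀ {x} → In x → In (farPair x)
  In-farPair x∈ = In-∧ (In-◇ⁿ 5 x∈) (In-◇ⁿ 5 (In-beyond 4 x∈))

  In-antipodes : ∀ {x} → In x → In (antipodes x)
  In-antipodes x∈ = In-∨ (In-beyond 4 x∈) (In-beyond 4 (In-beyond 4 x∈))

  In-atD : ∀ {x} → In x → In (atD x)
  In-atD x∈ = In-∧ (In-farPair x∈) (In-beyond 3 (In-sphere 3 (In-antipodes x∈)))

  In-⋁-map : ∀ {f : Carrier → Carrier} → (∀ {x} → In x → In (f x)) →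
             ∀ {xs} → All In xs → In (⋁ (map f xs))
  In-⋁-map f-In []         = In-𝟘
  In-⋁-map f-In (x∈ ∷ xs∈) = In-∨ (f-In x∈) (In-⋁-map f-In xs∈)

  In-candidates : ∀ {x} → In x → All In (candidates x)
  In-candidates {x} x∈ = p∈ ∷ q∈ ∷ In-beyond 3 (In-beyond 2 p∈) ∷ In-beyond 3 (In-beyond 2 q∈)
                       ∷ In-sphere 2 b∈ ∷ In-sphere 3 b∈ ∷ []
    where
    q∈ : In (beyond 1 x)
    q∈ = In-beyond 1 x∈
    p∈ : In (beyond 1 (beyond 1 x))
    p∈ = In-beyond 1 q∈
    b∈ : In (◇ (beyond 1 (beyond 1 x)) ∧ ◇ (beyond 1 x))
    b∈ = In-∧ (In-◇ p∈) (In-◇ q∈)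

  In-dTerm : ∀ {x} → In x → In (dTerm x)
  In-dTerm x∈ = In-⋁-map In-atD (In-candidates x∈)

distᵈ : W → ℕ
distᵈ d      = 0
distᵈ c₁     = 1
distᵈ b₁     = 2
distᵈ a      = 3
distᵈ b₂     = 4
distᵈ b₃     = 4
distᵈ (ℓ _)  = 4
distᵈ c₂     = 5
distᵈ (u₊ _) = 5

distᵈ≤5 : ∀ z → distᵈ z ≤ 5
distᵈ≤5 d      = ≤ᵇ⇒≤ _ _ tt
distᵈ≤5 c₁     = ≤ᵇ⇒≤ _ _ tt
distᵈ≤5 b₁     = ≤ᵇ⇒≤ _ _ tt
distᵈ≤5 a      = ≤ᵇ⇒≤ _ _ tt
distᵈ≤5 b₂     = ≤ᵇ⇒≤ _ _ tt
distᵈ≤5 b₃     = ≤ᵇ⇒≤ _ _ tt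
distᵈ≤5 (ℓ _)  = ≤ᵇ⇒≤ _ _ tt
distᵈ≤5 c₂     = ≤ᵇ⇒≤ _ _ tt
distᵈ≤5 (u₊ _) = ≤ᵇ⇒≤ _ _ tt

Rim : W → Set
Rim z = distᵈ z ≡ 5

Pole : W → Set
Pole z = z ≡ d ⊎ Rim z

_≟d : ∀ z → Dec (z ≡ d)
d      ≟d = yes refl
a      ≟d = no λ ()
b₁     ≟d = no λ ()
b₂     ≟d = no λ ()
b₃     ≟d = no λ ()
c₁     ≟d = no λ ()
c₂     ≟d = no λ ()
u₊ _   ≟d = no λ ()
ℓ _    ≟d = no λ ()

module Frame (N : SubsetE) where

  infixr 5 _▸_
  data Walk : ℕ → W → W → Set where
    stop : ∀ {x} → Walk 0 x x
    _▸_  : ∀ {k x y z} → R N x y → Walk k y z → Walk (suc k) x z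

  R-refl : ∀ {x} → R N x x
  R-refl = inj₁ refl

  edge : ∀ {x y} → Edge N x y → R N x y
  edge e = inj₂ (inj₁ e)

  edge˘ : ∀ {x y} → Edge N y x → R N x y
  edge˘ e = inj₂ (inj₂ e)

  R-sym : ∀ {x y} → R N x y → R N y x
  R-sym (inj₁ refl)     = inj₁ refl
  R-sym (inj₂ (inj₁ e)) = edge˘ e
  R-sym (inj₂ (inj₂ e)) = edge e

  stay : ∀ n {x} → Walk n x x
  stay zero    = stop
  stay (suc n) = R-refl ▸ stay n

  pad : ∀ {m n x y} → m ≤ n → Walk m x y → Walk n x y
  pad {n = n} z≤n stop = stay n
  pad (s≤s m≤n) (r ▸ w) = r ▸ pad m≤n w

  _++_ : ∀ {m n x y z} → Walk m x y → Walk n y z → Walk (m + n) x z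
  stop    ++ w′ = w′
  (r ▸ w) ++ w′ = r ▸ (w ++ w′)

  infixl 5 _▸ʳ_
  _▸ʳ_ : ∀ {k x y z} → Walk k x y → R N y z → Walk (suc k) x z
  stop    ▸ʳ r′ = r′ ▸ stop
  (r ▸ w) ▸ʳ r′ = r ▸ (w ▸ʳ r′)

  reverse : ∀ {k x y} → Walk k x y → Walk k y x
  reverse stop    = stop
  reverse (r ▸ w) = reverse w ▸ʳ R-sym r

  open Terms (Cm N) public
  open BAO (Cm N) public using (◇)

  walk⇒◇ⁿ : ∀ {k x y} {Z : W → Set} → Walk k x y → Z y → ◇ⁿ k Z x
  walk⇒◇ⁿ stop              z = z
  walk⇒◇ⁿ (_▸_ {y = y} r w) z = y , r , walk⇒◇ⁿ w z

  ◇ⁿ⇒walk : ∀ k {x} {Z : W → Set} → ◇ⁿ k Z x → ∃ λ y → Walk k x y × Z y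
  ◇ⁿ⇒walk zero    {x} z           = x , stop , z
  ◇ⁿ⇒walk (suc k) (_ , r , ◇ᵏZ) with ◇ⁿ⇒walk k ◇ᵏZ
  ... | y , w , z = y , r ▸ w , z

  d⇝a : Walk 3 d a
  d⇝a = stop ▸ʳ edge˘ c₁d ▸ʳ edge˘ b₁c₁ ▸ʳ edge˘ ab₁

  edge-distᵈ : ∀ {x y} → Edge N x y → distᵈ y ≤ suc (distᵈ x) × distᵈ x ≤ suc (distᵈ y)
  edge-distᵈ ab₁             = ≤ᵇ⇒≤ _ _ tt , ≤ᵇ⇒≤ _ _ tt
  edge-distᵈ ab₂             = ≤ᵇ⇒≤ _ _ tt , ≤ᵇ⇒≤ _ _ tt
  edge-distᵈ ab₃             = ≤ᵇ⇒≤ _ _ tt , ≤ᵇ⇒≤ _ _ tt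
  edge-distᵈ b₁c₁            = ≤ᵇ⇒≤ _ _ tt , ≤ᵇ⇒≤ _ _ tt
  edge-distᵈ b₂c₂            = ≤ᵇ⇒≤ _ _ tt , ≤ᵇ⇒≤ _ _ tt
  edge-distᵈ c₁d             = ≤ᵇ⇒≤ _ _ tt , ≤ᵇ⇒≤ _ _ tt
  edge-distᵈ ℓ₀ℓ₁            = ≤ᵇ⇒≤ _ _ tt , ≤ᵇ⇒≤ _ _ tt
  edge-distᵈ (aℓ _)          = ≤ᵇ⇒≤ _ _ tt , ≤ᵇ⇒≤ _ _ tt
  edge-distᵈ (ℓu-same _)     = ≤ᵇ⇒≤ _ _ tt , ≤ᵇ⇒≤ _ _ tt
  edge-distᵈ (ℓu-pred _ _)   = ≤ᵇ⇒≤ _ _ tt , ≤ᵇ⇒≤ _ _ tt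
  edge-distᵈ (ℓu-succ _ _)   = ≤ᵇ⇒≤ _ _ tt , ≤ᵇ⇒≤ _ _ tt
  edge-distᵈ (ℓu-EN _ _ _)   = ≤ᵇ⇒≤ _ _ tt , ≤ᵇ⇒≤ _ _ tt

  R-distᵈ : ∀ {x y} → R N x y → distᵈ y ≤ suc (distᵈ x)
  R-distᵈ (inj₁ refl)     = n≤1+n _
  R-distᵈ (inj₂ (inj₁ e)) = proj₁ (edge-distᵈ e)
  R-distᵈ (inj₂ (inj₂ e)) = proj₂ (edge-distᵈ e)

  walk-distᵈ : ∀ {k x y} → Walk k x y → distᵈ y ≤ distᵈ x + k
  walk-distᵈ {x = x} stop = ≤-reflexive (sym (+-identityʳ (distᵈ x)))
  walk-distᵈ {suc k} {x} {z} (_▸_ {y = y} r w) = begin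
    distᵈ z           ≤⟨ walk-distᵈ w ⟩
    distᵈ y + k       ≤⟨ +-monoˡ-≤ k (R-distᵈ r) ⟩
    suc (distᵈ x) + k ≡⟨ sym (+-suc (distᵈ x) k) ⟩
    distᵈ x + suc k   ∎
    where open ≤-Reasoning

  walk-from-d : ∀ z → Walk (distᵈ z) d z
  walk-from-d d      = stop
  walk-from-d c₁     = stop ▸ʳ edge˘ c₁d
  walk-from-d b₁     = stop ▸ʳ edge˘ c₁d ▸ʳ edge˘ b₁c₁
  walk-from-d a      = d⇝a
  walk-from-d b₂     = d⇝a ▸ʳ edge ab₂
  walk-from-d b₃     = d⇝a ▸ʳ edge ab₃
  walk-from-d (ℓ i)  = d⇝a ▸ʳ edge (aℓ i)
  walk-from-d c₂     = d⇝a ▸ʳ edge ab₂ ▸ʳ edge b₂c₂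
  walk-from-d (u₊ k) = d⇝a ▸ʳ edge (aℓ (suc k)) ▸ʳ edge (ℓu-same k)

  rim-not-within-4-of-d : ∀ {z} → Rim z → ¬ Walk 4 d z
  rim-not-within-4-of-d rim w = <-irrefl refl (subst (_≤ 4) rim (walk-distᵈ w))

  walk-to-a : ∀ {z} → z ≢ d → Walk 2 z a
  walk-to-a {a}      _   = stay 2
  walk-to-a {b₁}     _   = stay 1 ▸ʳ edge˘ ab₁
  walk-to-a {b₂}     _   = stay 1 ▸ʳ edge˘ ab₂
  walk-to-a {b₃}     _   = stay 1 ▸ʳ edge˘ ab₃
  walk-to-a {ℓ i}    _   = stay 1 ▸ʳ edge˘ (aℓ i)
  walk-to-a {c₁}     _   = stop ▸ʳ edge˘ b₁c₁ ▸ʳ edge˘ ab₁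
  walk-to-a {c₂}     _   = stop ▸ʳ edge˘ b₂c₂ ▸ʳ edge˘ ab₂
  walk-to-a {u₊ k}   _   = stop ▸ʳ edge˘ (ℓu-same k) ▸ʳ edge˘ (aℓ (suc k))
  walk-to-a {d}      z≢d = contradiction refl z≢d

  nbrs-d : ∀ {y} → R N d y → y ≡ d ⊎ y ≡ c₁
  nbrs-d (inj₁ refl)       = inj₁ refl
  nbrs-d (inj₂ (inj₁ ()))
  nbrs-d (inj₂ (inj₂ c₁d)) = inj₂ refl

  nbrs-b₁ : ∀ {y} → R N b₁ y → y ≡ b₁ ⊎ y ≡ c₁ ⊎ y ≡ a
  nbrs-b₁ (inj₁ refl)        = inj₁ refl
  nbrs-b₁ (inj₂ (inj₁ b₁c₁)) = inj₂ (inj₁ refl)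
  nbrs-b₁ (inj₂ (inj₂ ab₁))  = inj₂ (inj₂ refl)

  nbrs-b₂ : ∀ {y} → R N b₂ y → y ≡ b₂ ⊎ y ≡ c₂ ⊎ y ≡ a
  nbrs-b₂ (inj₁ refl)        = inj₁ refl
  nbrs-b₂ (inj₂ (inj₁ b₂c₂)) = inj₂ (inj₁ refl)
  nbrs-b₂ (inj₂ (inj₂ ab₂))  = inj₂ (inj₂ refl)

  nbrs-c₂ : ∀ {y} → R N c₂ y → y ≡ c₂ ⊎ y ≡ b₂
  nbrs-c₂ (inj₁ refl)        = inj₁ refl
  nbrs-c₂ (inj₂ (inj₁ ()))
  nbrs-c₂ (inj₂ (inj₂ b₂c₂)) = inj₂ refl

  within3-of-d : ∀ {y} → Walk 3 d y → y ≡ a ⊎ Walk 2 y d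
  within3-of-d {y} w = classify y (walk-distᵈ w)
    where
    classify : ∀ y → distᵈ y ≤ 3 → y ≡ a ⊎ Walk 2 y d
    classify a      _ = inj₁ refl
    classify d      _ = inj₂ (stay 2)
    classify c₁     _ = inj₂ (stay 1 ▸ʳ edge c₁d)
    classify b₁     _ = inj₂ (stop ▸ʳ edge b₁c₁ ▸ʳ edge c₁d)
    classify b₂     (s≤s (s≤s (s≤s ())))
    classify b₃     (s≤s (s≤s (s≤s ())))
    classify (ℓ _)  (s≤s (s≤s (s≤s ())))
    classify c₂     (s≤s (s≤s (s≤s ())))
    classify (u₊ _) (s≤s (s≤s (s≤s ())))

  within2-of-d : ∀ {y} → Walk 2 d y → y ≡ d ⊎ y ≡ c₁ ⊎ y ≡ b₁
  within2-of-d {y} w = classify y (walk-distᵈ w)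
    where
    classify : ∀ y → distᵈ y ≤ 2 → y ≡ d ⊎ y ≡ c₁ ⊎ y ≡ b₁
    classify d      _ = inj₁ refl
    classify c₁     _ = inj₂ (inj₁ refl)
    classify b₁     _ = inj₂ (inj₂ refl)
    classify a      (s≤s (s≤s ()))
    classify b₂     (s≤s (s≤s ()))
    classify b₃     (s≤s (s≤s ()))
    classify (ℓ _)  (s≤s (s≤s ()))
    classify c₂     (s≤s (s≤s ()))
    classify (u₊ _) (s≤s (s≤s ()))

  data Antipodal : W → W → Set where
    d-rim : ∀ {z} → Rim z → Antipodal d z
    rim-d : ∀ {z} → Rim z → Antipodal z d

  antipodal⇒¬walk4 : ∀ {x y} → Antipodal x y → ¬ Walk 4 x y
  antipodal⇒¬walk4 (d-rim rim) w = rim-not-within-4-of-d rim w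
  antipodal⇒¬walk4 (rim-d rim) w = rim-not-within-4-of-d rim (reverse w)

  walk4-from-d-or-rim : ∀ z → Walk 4 d z ⊎ Rim z
  walk4-from-d-or-rim z with distᵈ z ≤? 4
  ... | yes z≤4 = inj₁ (pad z≤4 (walk-from-d z))
  ... | no  z≰4 = inj₂ (≤-antisym (distᵈ≤5 z) (≰⇒> z≰4))

  walk4-or-antipodal : ∀ x y → Walk 4 x y ⊎ Antipodal x y
  walk4-or-antipodal x y with x ≟d | y ≟d
  ... | no x≢d   | no y≢d   = inj₁ (walk-to-a x≢d ++ reverse (walk-to-a y≢d))
  ... | yes refl | _        = Sum.map₂ d-rim (walk4-from-d-or-rim y)
  ... | no _     | yes refl = Sum.map reverse rim-d (walk4-from-d-or-rim x)

  beyond4⇒antipodal : ∀ {A : W → Set} {z y} → beyond 4 A z → A y → Antipodal z y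
  beyond4⇒antipodal {z = z} {y} z∉◇⁴A y∈A with walk4-or-antipodal z y
  ... | inj₁ w   = contradiction (walk⇒◇ⁿ w y∈A) z∉◇⁴A
  ... | inj₂ ant = ant

  antipodal-from-d : ∀ {y} → Antipodal d y → Rim y
  antipodal-from-d (d-rim rim) = rim
  antipodal-from-d (rim-d ())

  antipodal-from-rim : ∀ {z y} → Rim z → Antipodal z y → y ≡ d
  antipodal-from-rim ()  (d-rim _)
  antipodal-from-rim _   (rim-d _) = refl

  antipodal-sym : ∀ {x y} → Antipodal x y → Antipodal y x
  antipodal-sym (d-rim rim) = rim-d rim
  antipodal-sym (rim-d rim) = d-rim rim

  Polar : (W → Set) → Set
  Polar A = Satisfiable A × (A ⊆ (_≡ d) ⊎ A ⊆ Rim)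

  beyond4-of-d : ∀ {A : W → Set} → A d → A ⊆ (_≡ d) → beyond 4 A ≐ Rim
  beyond4-of-d d∈A A⊆d =
      (λ z∉◇⁴A → antipodal-from-d (antipodal-sym (beyond4⇒antipodal z∉◇⁴A d∈A)))
    , λ rim ◇⁴A → case ◇ⁿ⇒walk 4 ◇⁴A of λ where
        (y , w , y∈A) → antipodal⇒¬walk4 (rim-d rim) (subst (Walk 4 _) (A⊆d y∈A) w)

  beyond4-of-rim : ∀ {A : W → Set} {z₀} → A z₀ → A ⊆ Rim → beyond 4 A ≐ (_≡ d)
  beyond4-of-rim z₀∈A A⊆rim =
      (λ z∉◇⁴A → antipodal-from-rim (A⊆rim z₀∈A) (antipodal-sym (beyond4⇒antipodal z∉◇⁴A z₀∈A)))
    , λ { refl ◇⁴A → case ◇ⁿ⇒walk 4 ◇⁴A of λ where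
            (y , w , y∈A) → antipodal⇒¬walk4 (d-rim (A⊆rim y∈A)) w }

  antipodes-of-polar : ∀ {A : W → Set} → Polar A → antipodes A ≐ Pole
  antipodes-of-polar {A} ((z₀ , z₀∈A) , inj₁ A⊆d) with A⊆d z₀∈A
  ... | refl = Sum.swap ∘ Sum.map (proj₁ far) (proj₁ far²)
             , Sum.map (proj₂ far) (proj₂ far²) ∘ Sum.swap
    where
    far : beyond 4 A ≐ Rim
    far = beyond4-of-d z₀∈A A⊆d
    far² : beyond 4 (beyond 4 A) ≐ (_≡ d)
    far² = beyond4-of-rim {z₀ = c₂} (proj₂ far refl) (proj₁ far)
  antipodes-of-polar {A} ((z₀ , z₀∈A) , inj₂ A⊆rim) =
    Sum.map (proj₁ far) (proj₁ far²) , Sum.map (proj₂ far) (proj₂ far²)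
    where
    far : beyond 4 A ≐ (_≡ d)
    far = beyond4-of-rim z₀∈A A⊆rim
    far² : beyond 4 (beyond 4 A) ≐ Rim
    far² = beyond4-of-d (proj₂ far refl) (proj₁ far)

  a-nbr-not-pole : ∀ {y} → R N a y → ¬ Pole y
  a-nbr-not-pole r (inj₁ refl) = contradiction (R-distᵈ (R-sym r)) λ { (s≤s ()) }
  a-nbr-not-pole r (inj₂ rim)  = <-irrefl refl (subst (_≤ 4) rim (R-distᵈ r))

  nbrs-b₃ : ∀ {y} → R N b₃ y → y ≡ b₃ ⊎ y ≡ a
  nbrs-b₃ (inj₁ refl)       = inj₁ refl
  nbrs-b₃ (inj₂ (inj₁ ()))
  nbrs-b₃ (inj₂ (inj₂ ab₃)) = inj₂ refl

  b₃-ball2⊆a-nbrs : ∀ {y} → Walk 2 b₃ y → R N a y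
  b₃-ball2⊆a-nbrs (r ▸ r′ ▸ stop) with nbrs-b₃ r
  ... | inj₂ refl = r′
  ... | inj₁ refl with nbrs-b₃ r′
  ...   | inj₁ refl = edge ab₃
  ...   | inj₂ refl = R-refl

  walk2-to-pole : ∀ z → z ≡ b₃ ⊎ ∃ λ y → Walk 2 z y × Pole y
  walk2-to-pole a           = inj₂ (c₂ , stop ▸ʳ edge ab₂ ▸ʳ edge b₂c₂ , inj₂ refl)
  walk2-to-pole b₁          = inj₂ (d , stop ▸ʳ edge b₁c₁ ▸ʳ edge c₁d , inj₁ refl)
  walk2-to-pole b₂          = inj₂ (c₂ , stay 1 ▸ʳ edge b₂c₂ , inj₂ refl)
  walk2-to-pole b₃          = inj₁ refl
  walk2-to-pole c₁          = inj₂ (d , stay 1 ▸ʳ edge c₁d , inj₁ refl)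
  walk2-to-pole c₂          = inj₂ (c₂ , stay 2 , inj₂ refl)
  walk2-to-pole d           = inj₂ (d , stay 2 , inj₁ refl)
  walk2-to-pole (u₊ k)      = inj₂ (u₊ k , stay 2 , inj₂ refl)
  walk2-to-pole (ℓ zero)    = inj₂ (u₊ 0 , stop ▸ʳ edge ℓ₀ℓ₁ ▸ʳ edge (ℓu-same 0) , inj₂ refl)
  walk2-to-pole (ℓ (suc k)) = inj₂ (u₊ k , stay 1 ▸ʳ edge (ℓu-same k) , inj₂ refl)

  sphere3-of-poles : ∀ {E : W → Set} → E ≐ Pole → sphere 3 E ≐ (_≡ b₃)
  sphere3-of-poles {E} (E⊆ , E⊇) = sphere⊆b₃ , λ { refl → ◇³E , ¬◇²E }
    where
    sphere⊆b₃ : sphere 3 E ⊆ (_≡ b₃)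
    sphere⊆b₃ {z} (_ , z∉◇²E) with walk2-to-pole z
    ... | inj₁ z≡b₃          = z≡b₃
    ... | inj₂ (y , w , pole) = contradiction (walk⇒◇ⁿ w (E⊇ pole)) z∉◇²E
    ◇³E : ◇ⁿ 3 E b₃
    ◇³E = walk⇒◇ⁿ (stop ▸ʳ edge˘ ab₃ ▸ʳ edge ab₂ ▸ʳ edge b₂c₂) (E⊇ (inj₂ refl))
    ¬◇²E : ¬ ◇ⁿ 2 E b₃
    ¬◇²E ◇²E with ◇ⁿ⇒walk 2 ◇²E
    ... | y , w , y∈E = a-nbr-not-pole (b₃-ball2⊆a-nbrs w) (E⊆ y∈E)

  beyond2⊆d : ∀ {B : W → Set} → B a → beyond 2 B ⊆ (_≡ d)
  beyond2⊆d a∈B {z} z∉◇²B with z ≟d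
  ... | yes z≡d = z≡d
  ... | no  z≢d = contradiction (walk⇒◇ⁿ (walk-to-a z≢d) a∈B) z∉◇²B

  beyond3⊆d : ∀ {B : W → Set} → B b₃ → beyond 3 B ⊆ (_≡ d)
  beyond3⊆d b₃∈B {z} z∉◇³B with z ≟d
  ... | yes z≡d = z≡d
  ... | no  z≢d = contradiction (walk⇒◇ⁿ (walk-to-a z≢d ▸ʳ edge ab₃) b₃∈B) z∉◇³B

  beyond3-of-b₃ : ∀ {B : W → Set} → B ≐ (_≡ b₃) → beyond 3 B ≐ (_≡ d)
  beyond3-of-b₃ {B} (B⊆ , B⊇) = beyond3⊆d (B⊇ refl) , λ { refl ◇³B → d-far-from-B ◇³B }
    where
    d-far-from-B : ¬ ◇ⁿ 3 B d
    d-far-from-B ◇³B with ◇ⁿ⇒walk 3 ◇³B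
    ... | y , w , y∈B with B⊆ y∈B
    ... | refl = <-irrefl refl (walk-distᵈ w)

  farPair⇒polar : ∀ {A : W → Set} {w} → farPair A w → Polar A
  farPair⇒polar (◇⁵A , ◇⁵B) with ◇ⁿ⇒walk 5 ◇⁵A | ◇ⁿ⇒walk 5 ◇⁵B
  ... | y , _ , y∈A | z , _ , z∉◇⁴A with beyond4⇒antipodal z∉◇⁴A y∈A
  ... | d-rim _   = (y , y∈A) , inj₂ (antipodal-from-d ∘ beyond4⇒antipodal z∉◇⁴A)
  ... | rim-d rim = (y , y∈A) , inj₁ (antipodal-from-rim rim ∘ beyond4⇒antipodal z∉◇⁴A)

  polar⇒farPair-d : ∀ {A : W → Set} → Polar A → farPair A d
  polar⇒farPair-d {A} polar@((z₀ , z₀∈A) , _) =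
    walk⇒◇ⁿ (within5 z₀) z₀∈A , walk⇒◇ⁿ (within5 (proj₁ far)) (proj₂ far)
    where
    within5 : ∀ z → Walk 5 d z
    within5 z = pad (distᵈ≤5 z) (walk-from-d z)
    far : Satisfiable (beyond 4 A)
    far with polar
    ... | _ , inj₁ A⊆d with A⊆d z₀∈A
    ...   | refl = c₂ , proj₂ (beyond4-of-d z₀∈A A⊆d) refl
    far | _ , inj₂ A⊆rim = d , proj₂ (beyond4-of-rim z₀∈A A⊆rim) refl

  beyond3-sphere3-antipodes-of-polar : ∀ {A : W → Set} → Polar A →
                                       beyond 3 (sphere 3 (antipodes A)) ≐ (_≡ d)
  beyond3-sphere3-antipodes-of-polar = beyond3-of-b₃ ∘ sphere3-of-poles ∘ antipodes-of-polar

  atD⊆d : ∀ {A : W → Set} → atD A ⊆ (_≡ d)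
  atD⊆d (pair , w∈) = proj₁ (beyond3-sphere3-antipodes-of-polar (farPair⇒polar pair)) w∈

  polar⇒atD-d : ∀ {A : W → Set} → Polar A → atD A d
  polar⇒atD-d polar = polar⇒farPair-d polar , proj₂ (beyond3-sphere3-antipodes-of-polar polar) refl

  ⋁-map⁻ : ∀ {f : (W → Set) → W → Set} cs {w} → ⋁ (map f cs) w → Any (λ c → f c w) cs
  ⋁-map⁻ (_ ∷ _)  (inj₁ p) = here p
  ⋁-map⁻ (_ ∷ cs) (inj₂ p) = there (⋁-map⁻ cs p)

  ⋁-map⁺ : ∀ {f : (W → Set) → W → Set} {cs w} → Any (λ c → f c w) cs → ⋁ (map f cs) w
  ⋁-map⁺ (here p)  = inj₁ p
  ⋁-map⁺ (there p) = inj₂ (⋁-map⁺ p)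

  ⊆-beyond1² : ∀ {X : W → Set} → X ⊆ beyond 1 (beyond 1 X)
  ⊆-beyond1² x∈X (y , r , y∈Q) = y∈Q (_ , R-sym r , x∈X)

  Dual : (W → Set) → (W → Set) → Set
  Dual P Q = Q ≐ beyond 1 P

  beyond²-dual : ∀ {X : W → Set} → Dual (beyond 1 (beyond 1 X)) (beyond 1 X)
  beyond²-dual =
      (λ w∈Q (x , r , x∈P) → x∈P (_ , R-sym r , w∈Q))
    , λ w∉◇P (x , r , x∈X) → w∉◇P (x , r , ⊆-beyond1² x∈X)

  beyond-dual : ∀ {Q : W → Set} → Dual Q (beyond 1 Q)
  beyond-dual = (λ p → p) , (λ p → p)

module DTermInCm (N : SubsetE) (em : ExcludedMiddle lzero) where
  open Frame N
  open BAO (Cm N) using (_∧_)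

  dne : ∀ {A : Set} → ¬ ¬ A → A
  dne {A} ¬¬A with em {A}
  ... | yes x = x
  ... | no ¬x = contradiction ¬x ¬¬A

  polar-from-a∈P : ∀ {P Q : W → Set} → Dual P Q → P a → Satisfiable Q →
                   Polar Q ⊎ Polar (beyond 3 (beyond 2 Q))
  polar-from-a∈P {P} {Q} (Q⊆ , Q⊇) a∈P Q≠∅ with em {Q d}
  ... | no d∉Q = inj₁ (Q≠∅ , inj₂ Q⊆rim)
    where
    a-nbr∉Q : ∀ {y} → Q y → ¬ R N a y
    a-nbr∉Q y∈Q r = Q⊆ y∈Q (a , R-sym r , a∈P)
    Q⊆rim : Q ⊆ Rim
    Q⊆rim {a}    q = contradiction R-refl (a-nbr∉Q q)
    Q⊆rim {b₁}   q = contradiction (edge ab₁) (a-nbr∉Q q)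
    Q⊆rim {b₂}   q = contradiction (edge ab₂) (a-nbr∉Q q)
    Q⊆rim {b₃}   q = contradiction (edge ab₃) (a-nbr∉Q q)
    Q⊆rim {ℓ i}  q = contradiction (edge (aℓ i)) (a-nbr∉Q q)
    Q⊆rim {d}    q = contradiction q d∉Q
    Q⊆rim {c₁}   q = contradiction (Q⊇ λ (x , r , x∈P) → Q⊆ q (x , c₁-nbr r , x∈P)) d∉Q
      where
      c₁-nbr : ∀ {x} → R N d x → R N c₁ x
      c₁-nbr r with nbrs-d r
      ... | inj₁ refl = edge c₁d
      ... | inj₂ refl = R-refl
    Q⊆rim {c₂}   _ = refl
    Q⊆rim {u₊ _} _ = refl
  ... | yes d∈Q with em {◇ⁿ 2 Q a}
  ...   | no ¬◇²Q = inj₁ (Q≠∅ , inj₁ Q⊆d)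
    where
    Q⊆d : Q ⊆ (_≡ d)
    Q⊆d {z} q with z ≟d
    ... | yes z≡d = z≡d
    ... | no  z≢d = contradiction (walk⇒◇ⁿ (reverse (walk-to-a z≢d)) q) ¬◇²Q
  ...   | yes ◇²Q = inj₂ ((d , d-far) , inj₁ (beyond3⊆d b₃-far))
    where
    d-far : ¬ ◇ⁿ 3 (beyond 2 Q) d
    d-far ◇³ with ◇ⁿ⇒walk 3 ◇³
    ... | y , w , y∉◇²Q with within3-of-d w
    ...   | inj₁ refl = y∉◇²Q ◇²Q
    ...   | inj₂ w′   = y∉◇²Q (walk⇒◇ⁿ w′ d∈Q)
    b₃-far : ¬ ◇ⁿ 2 Q b₃
    b₃-far ◇² with ◇ⁿ⇒walk 2 ◇²
    ... | y , w , y∈Q = Q⊆ y∈Q (a , R-sym (b₃-ball2⊆a-nbrs w) , a∈P)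

  module Boundary {P Q : W → Set} (dual-PQ : Dual P Q) (dual-QP : Dual Q P)
                  (a∉P : ¬ P a) (a∉Q : ¬ Q a) where
    open Σ dual-PQ renaming (proj₁ to Q⊆; proj₂ to Q⊇)
    open Σ dual-QP renaming (proj₁ to P⊆; proj₂ to P⊇)

    B : W → Set
    B = ◇ P ∧ ◇ Q

    a∈B : B a
    a∈B = dne (a∉Q ∘ Q⊇) , dne (a∉P ∘ P⊇)

    -- A point of B has a P-neighbour and a Q-neighbour, distinct from it, from a and from each other.
    ¬B-of : ∀ {w} v → (∀ {x} → R N w x → x ≡ w ⊎ x ≡ v ⊎ x ≡ a) → ¬ B w
    ¬B-of {w} v nbrs ((p , rp , p∈P) , (q , rq , q∈Q)) with nbrs rp | nbrs rq
    ... | inj₁ refl        | _                = P⊆ p∈P (q , rq , q∈Q)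
    ... | inj₂ (inj₂ refl) | _                = a∉P p∈P
    ... | _                | inj₁ refl        = Q⊆ q∈Q (p , rp , p∈P)
    ... | _                | inj₂ (inj₂ refl) = a∉Q q∈Q
    ... | inj₂ (inj₁ refl) | inj₂ (inj₁ refl) = Q⊆ q∈Q (v , R-refl , p∈P)

    ¬B-d : ¬ B d
    ¬B-d = ¬B-of c₁ (Sum.map₂ inj₁ ∘ nbrs-d)

    ¬B-b₁ : ¬ B b₁
    ¬B-b₁ = ¬B-of c₁ nbrs-b₁

    ¬B-b₂ : ¬ B b₂
    ¬B-b₂ = ¬B-of c₂ nbrs-b₂

    ¬B-c₂ : ¬ B c₂
    ¬B-c₂ = ¬B-of b₂ (Sum.map₂ inj₁ ∘ nbrs-c₂)

    polar : Polar (sphere 2 B) ⊎ Polar (sphere 3 B)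
    polar with em {B c₁}
    ... | no c₁∉B = inj₂ ((d , walk⇒◇ⁿ d⇝a a∈B , ¬◇²B-d) , inj₁ (beyond2⊆d a∈B ∘ proj₂))
      where
      ¬◇²B-d : ¬ ◇ⁿ 2 B d
      ¬◇²B-d ◇²B with ◇ⁿ⇒walk 2 ◇²B
      ... | y , w , y∈B with within2-of-d w
      ...   | inj₁ refl        = ¬B-d y∈B
      ...   | inj₂ (inj₁ refl) = c₁∉B y∈B
      ...   | inj₂ (inj₂ refl) = ¬B-b₁ y∈B
    ... | yes c₁∈B = inj₁ ((c₂ , walk⇒◇ⁿ (walk-to-a λ ()) a∈B , ¬◇B-c₂) , inj₂ sphere⊆rim)
      where
      ¬◇B-c₂ : ¬ ◇ B c₂
      ¬◇B-c₂ (x , r , x∈B) with nbrs-c₂ r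
      ... | inj₁ refl = ¬B-c₂ x∈B
      ... | inj₂ refl = ¬B-b₂ x∈B
      sphere⊆rim : sphere 2 B ⊆ Rim
      sphere⊆rim {a}    (_ , ¬◇B) = contradiction (a , R-refl , a∈B) ¬◇B
      sphere⊆rim {b₁}   (_ , ¬◇B) = contradiction (a , edge˘ ab₁ , a∈B) ¬◇B
      sphere⊆rim {b₂}   (_ , ¬◇B) = contradiction (a , edge˘ ab₂ , a∈B) ¬◇B
      sphere⊆rim {b₃}   (_ , ¬◇B) = contradiction (a , edge˘ ab₃ , a∈B) ¬◇B
      sphere⊆rim {ℓ i}  (_ , ¬◇B) = contradiction (a , edge˘ (aℓ i) , a∈B) ¬◇B
      sphere⊆rim {c₁}   (_ , ¬◇B) = contradiction (c₁ , R-refl , c₁∈B) ¬◇B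
      sphere⊆rim {d}    (_ , ¬◇B) = contradiction (c₁ , edge˘ c₁d , c₁∈B) ¬◇B
      sphere⊆rim {c₂}   _         = refl
      sphere⊆rim {u₊ _} _         = refl

  polar-from-a∉P∪Q : ∀ {P Q : W → Set} → Dual P Q → Dual Q P → ¬ P a → ¬ Q a →
                     Polar (sphere 2 (◇ P ∧ ◇ Q)) ⊎ Polar (sphere 3 (◇ P ∧ ◇ Q))
  polar-from-a∉P∪Q dual-PQ dual-QP a∉P a∉Q = Boundary.polar dual-PQ dual-QP a∉P a∉Q

  some-candidate-polar : ∀ {X : W → Set} → Satisfiable X → Satisfiable (beyond 1 X) →
                         Any Polar (candidates X)
  some-candidate-polar {X} (x , x∈X) Q≠∅ with em {beyond 1 (beyond 1 X) a} | em {beyond 1 X a}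
  ... | yes a∈P | _ = [ (λ p → there (here p)) , (λ p → there (there (there (here p)))) ]′
                        (polar-from-a∈P beyond²-dual a∈P Q≠∅)
  ... | no _    | yes a∈Q = [ here , (λ p → there (there (here p))) ]′
                              (polar-from-a∈P beyond-dual a∈Q (x , ⊆-beyond1² x∈X))
  ... | no a∉P  | no a∉Q = [ (λ p → there (there (there (there (here p)))))
                           , (λ p → there (there (there (there (there (here p)))))) ]′
                             (polar-from-a∉P∪Q beyond²-dual beyond-dual a∉P a∉Q)

  open BAO (Cm N) using (_≈_; 𝟘; 𝟙)

  dTerm≈d : ∀ {X : W → Set} → ¬ X ≈ 𝟘 → ¬ ◇ X ≈ 𝟙 → dTerm X ≈ (_≡ d)
  dTerm≈d {X} X≉𝟘 ◇X≉𝟙 w = mk⇔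
    (λ t → atD⊆d (proj₂ (satisfied (⋁-map⁻ {f = atD} (candidates X) t))))
    (λ { refl → ⋁-map⁺ {f = atD} (Any.map polar⇒atD-d (some-candidate-polar X≠∅ Q≠∅)) })
    where
    X≠∅ : Satisfiable X
    X≠∅ = dne λ X=∅ → X≉𝟘 λ w → mk⇔ (λ x∈X → X=∅ (w , x∈X)) ⊥-elim
    Q≠∅ : Satisfiable (beyond 1 X)
    Q≠∅ = dne λ Q=∅ → ◇X≉𝟙 λ w → mk⇔ (λ _ → tt) (λ _ → dne λ w∈Q → Q=∅ (w , w∈Q))

module _ {I : Set} (F : Ultrafilter I) where
  open Ultrafilter F

  ¬Mem⇒Mem-∁ : ∀ {A : I → Set} → ¬ Mem A → Mem (λ i → ¬ A i)
  ¬Mem⇒Mem-∁ {A} A∉F with ultra A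
  ... | inj₁ A∈F  = contradiction A∈F A∉F
  ... | inj₂ ∁A∈F = ∁A∈F

  Mem-const⇒ : ExcludedMiddle lzero → ∀ {P : Set} → Mem (λ _ → P) → P
  Mem-const⇒ em {P} P∈F with em {P}
  ... | yes p = p
  ... | no ¬p = contradiction (upward (λ _ → ¬p) P∈F) proper

  diagonal-embedding : ∀ {c s} (A : BAO c lzero) → ExcludedMiddle lzero →
    (let open BAO A in ∀ {x} → x ≈ x) →
    (S : Subalgebra (Ultrapower A I F) s) → (∀ x → Subalgebra.In S (λ _ → x)) →
    EmbedsInto A (Ultrapower A I F) S
  diagonal-embedding A em ≈-refl S consts-in = record
    { h      = λ x _ → x
    ; into   = consts-in
    ; cong   = everywhere
    ; inj    = Mem-const⇒ em
    ; pres-𝟘 = everywhere ≈-refl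
    ; pres-𝟙 = everywhere ≈-refl
    ; pres-∨ = λ _ _ → everywhere ≈-refl
    ; pres-∧ = λ _ _ → everywhere ≈-refl
    ; pres-∁ = λ _ → everywhere ≈-refl
    ; pres-◇ = λ _ → everywhere ≈-refl
    }
    where
    everywhere : ∀ {P : Set} → P → Mem (λ _ → P)
    everywhere p = upward (λ _ _ → p) full

module _ {N : SubsetE} {I : Set} {F : Ultrafilter I} {s}
         (S : Subalgebra (Ultrapower (D N) I F) s) where
  open Subalgebra S
  open Ultrafilter F

  consts-in-from-d : In (λ _ → (_≡ d) , gen-d) → ∀ X → In (λ _ → X)
  consts-in-from-d d∈S (_ , X∈D) = go X∈D
    where
    go : ∀ {X} (X∈D : InD N X) → In (λ _ → X , X∈D)
    go gen-d         = d∈S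
    go gen-𝟘         = In-𝟘
    go gen-𝟙         = In-𝟙
    go (gen-∨ p q)   = In-∨ (go p) (go q)
    go (gen-∧ p q)   = In-∧ (go p) (go q)
    go (gen-∁ p)     = In-∁ (go p)
    go (gen-◇ p)     = In-◇ (go p)
    go (gen-≈ X≈Y p) = resp (upward (λ _ _ → X≈Y) full) (go p)

lemma3p12 : (lem : ∀ {ℓ} → ExcludedMiddle ℓ)
    → (N : SubsetE) (I : Set) (F : Ultrafilter I)
    → (S : Subalgebra (Ultrapower (D N) I F) (lsuc lzero))
    → SatisfiesCond S
    → EmbedsInto (D N) (Ultrapower (D N) I F) S
lemma3p12 lem N I F S (x , x∈S , x≉𝟘 , ◇x≉𝟙) =
  diagonal-embedding F (D N) lem (λ _ → ⇔.refl) S (consts-in-from-d {N = N} {F = F} S d∈S)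
  where
  open Ultrafilter F
  open Subalgebra S
  open DTermInCm N lem using (dTerm≈d)

  d∈S : In (λ _ → (_≡ d) , gen-d)
  d∈S = resp (upward (λ _ (x≉𝟘 , ◇x≉𝟙) → dTerm≈d x≉𝟘 ◇x≉𝟙)
                     (meet (¬Mem⇒Mem-∁ F x≉𝟘) (¬Mem⇒Mem-∁ F ◇x≉𝟙)))
             (TermsIn.In-dTerm S x∈S)
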